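{- Let $\mathcal G\le S_\infty$ be a cofinitary group, $z\in 2^{\mathbb N}$ non-periodic, and $\mathbb Q=\mathbb Q^z_{\mathcal G}$ the forcing defined below. For any $w\in W_{\mathcal G,X}\setminus\mathcal G$, the set of $q\in\mathbb Q$ with $w\in F^q$ is dense in $\mathbb Q$.
   Context: $S_\infty$ is the group of permutations of $\mathbb N$ with identity $\mathbf 1$; a subgroup is cofinitary if each non-identity element has only finitely many fixed points. $W_{\mathcal G,X}$ is the set of reduced words over $(\mathcal G\setminus\{\mathbf 1\})\cup\{X,X^{ -1}\}$ (the free product $\mathcal G*\mathbb F(X)$ in normal form); elements of $\mathcal G$ are identified with words of length at most one. For an injective partial function $s$ and $w\in W_{\mathcal G,X}$, $w[s]$ is obtained by substituting $s$ for $X$ and its partial inverse for $X^{ -1}$ and composing partial functions. $\mathrm{fix}(a)=\{n:a(n)=n\}$. A subword of $w=a_n\cdots a_1$ is a contiguous subword or the empty word. For nonempty $w=a_n\cdots a_1$, $\mathrm{path}(w,s,m)=\langle m_i:i<\alpha\rangle$ with $m_0=m$, $m_{i+1}=a_j[s](m_i)$ where $1\le j\le n$, $j\equiv i+1\pmod n$, $\alpha\le\omega$ maximal with all terms defined; $\mathrm{set}(w,s,m)$ is its set of values. A partial function $\tau$ exactly codes $t\in 2^l$ with parameter $m$ if $\tau^k(m)$ is defined and $\equiv t(k)\pmod 2$ for all $k<l$ and $\tau^l(m)$ is undefined. The forcing $\mathbb Q^z_{\mathcal G}$: conditions are triples $p=(s^p,F^p,\bar m^p)$ such that (a) $s^p$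 is a finite injective partial function from $\mathbb N$ to $\mathbb N$ and $F^p\subseteq W_{\mathcal G,X}\setminus\mathcal G$ is finite; (b) $\bar m^p$ is a partial function from $F^p$ to $\mathbb N$; (c) for each $w\in\operatorname{dom}(\bar m^p)$ there is $l$ such that $w[s^p]$ exactly codes $z\restriction l$ with parameter $\bar m^p(w)$; (d) for distinct $w,w'\in\operatorname{dom}(\bar m^p)$, $\mathrm{set}(w,s^p,\bar m^p(w))\cap\mathrm{set}(w',s^p,\bar m^p(w'))=\emptyset$. The order: $q\le p$ iff $s^q\supseteq s^p$, $F^q\supseteq F^p$, $\bar m^q\supseteq\bar m^p$, and for every $w\in F^p$ and every $m\in\mathrm{fix}(w[s^q])$ there is a nonempty subword $w'$ of $w$ with $\mathrm{set}(w,s^q,m)\cap\mathrm{fix}(w'[s^p])\neq\emptyset$. -}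

module Defs where

open import Data.Nat using (ℕ; zero; suc; _+_; _<_; _%_; _≟_)
open import Data.Bool using (Bool; true; false)
open import Data.List using (List; []; _∷_; _++_; reverse; length)
open import Data.List.Relation.Unary.All using (All)
open import Data.List.Relation.Unary.Any using (Any)
open import Data.List.Membership.Propositional using (_∈_)
open import Data.Maybe using (Maybe; just; nothing; _>>=_)
open import Data.Product using (Σ; ∃; _×_; _,_; proj₁; proj₂)
open import Relation.Binary.PropositionalEquality using (_≡_; _≢_)
open import Relation.Nullary using (¬_; yes; no)
open import Data.Empty using (⊥)
open import Data.Unit using (⊤)

record Perm : Set where
  field
    fun   : ℕ → ℕ
    inv   : ℕ → ℕ
    left  : ∀ n → fun (inv n) ≡ n
    right : ∀ n → inv (fun n) ≡ n
open Perm public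

_≈ₚ_ : Perm → Perm → Set
a ≈ₚ b = ∀ n → fun a n ≡ fun b n

idP : Perm
idP = record { fun = λ n → n ; inv = λ n → n
             ; left = λ n → Relation.Binary.PropositionalEquality.refl
             ; right = λ n → Relation.Binary.PropositionalEquality.refl }

_∘ₚ_ : Perm → Perm → Perm
a ∘ₚ b = record
  { fun = λ n → fun a (fun b n)
  ; inv = λ n → inv b (inv a n)
  ; left = λ n → Relation.Binary.PropositionalEquality.trans
                   (Relation.Binary.PropositionalEquality.cong (fun a) (left b (inv a n))) (left a n)
  ; right = λ n → Relation.Binary.PropositionalEquality.trans
                   (Relation.Binary.PropositionalEquality.cong (inv b) (right a (fun b n))) (right b n) }

_⁻¹ₚ : Perm → Perm
a ⁻¹ₚ = record { fun = inv a ; inv = fun a ; left = right a ; right = left a }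

record IsSubgroup (G : Perm → Set) : Set where
  field
    resp    : ∀ {a b} → a ≈ₚ b → G a → G b
    has-id  : G idP
    has-∘   : ∀ {a b} → G a → G b → G (a ∘ₚ b)
    has-⁻¹  : ∀ {a} → G a → G (a ⁻¹ₚ)

Cofinitary : (Perm → Set) → Set
Cofinitary G = ∀ a → G a → ¬ (a ≈ₚ idP) →
  Σ ℕ λ N → ∀ n → fun a n ≡ n → n < N

NonPeriodic : (ℕ → Bool) → Set
NonPeriodic z = ¬ (Σ ℕ λ k → (0 < k) × (∀ n → z (n + k) ≡ z n))

-- Words over (G ∖ {1}) ∪ {X, X⁻¹}.
-- A word a_n ⋯ a_1 is the list (a_n ∷ ⋯ ∷ a_1 ∷ []) (written order;
-- a_1 is applied first).

data Letter : Set where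
  gen : Perm → Letter
  X   : Letter
  X⁻  : Letter

Word : Set
Word = List Letter

_≈ₗ_ : Letter → Letter → Set
gen a ≈ₗ gen b = a ≈ₚ b
X ≈ₗ X = ⊤
X⁻ ≈ₗ X⁻ = ⊤
_ ≈ₗ _ = ⊥

data _≈w_ : Word → Word → Set where
  []  : [] ≈w []
  _∷_ : ∀ {a b u v} → a ≈ₗ b → u ≈w v → (a ∷ u) ≈w (b ∷ v)

GoodLetter : (Perm → Set) → Letter → Set
GoodLetter G (gen a) = G a × ¬ (a ≈ₚ idP)
GoodLetter G X = ⊤
GoodLetter G X⁻ = ⊤

BadPair : Letter → Letter → Set
BadPair (gen _) (gen _) = ⊤
BadPair X X⁻ = ⊤
BadPair X⁻ X = ⊤
BadPair _ _ = ⊥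

Reduced : Word → Set
Reduced [] = ⊤
Reduced (a ∷ []) = ⊤
Reduced (a ∷ b ∷ w) = ¬ BadPair a b × Reduced (b ∷ w)

InW : (Perm → Set) → Word → Set
InW G w = All (GoodLetter G) w × Reduced w

-- w ∉ G, where G is identified with the words of length ≤ 1 with no X
NotInG : Word → Set
NotInG w = (w ≢ []) × (∀ a → w ≢ (gen a ∷ []))

PFun : Set
PFun = List (ℕ × ℕ)

IsInjPFun : PFun → Set
IsInjPFun s = (∀ {a b b'} → (a , b) ∈ s → (a , b') ∈ s → b ≡ b')
            × (∀ {a a' b} → (a , b) ∈ s → (a' , b) ∈ s → a ≡ a')

app : PFun → ℕ → Maybe ℕ
app [] n = nothing
app ((a , b) ∷ s) n with a ≟ n
... | yes _ = just b
... | no _  = app s n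

appInv : PFun → ℕ → Maybe ℕ
appInv [] n = nothing
appInv ((a , b) ∷ s) n with b ≟ n
... | yes _ = just a
... | no _  = appInv s n

applyLetter : PFun → Letter → ℕ → Maybe ℕ
applyLetter s (gen a) n = just (fun a n)
applyLetter s X n = app s n
applyLetter s X⁻ n = appInv s n

applyWord : PFun → Word → ℕ → Maybe ℕ
applyWord s [] n = just n
applyWord s (a ∷ w) n = applyWord s w n >>= applyLetter s a

iterM : (ℕ → Maybe ℕ) → ℕ → ℕ → Maybe ℕ
iterM f zero m = just m
iterM f (suc k) m = iterM f k m >>= f

bit : Bool → ℕ
bit false = 0
bit true = 1

ExactlyCodes : (ℕ → Maybe ℕ) → (ℕ → Bool) → ℕ → ℕ → Set
ExactlyCodes τ z l m =
  (∀ k → k < l → Σ ℕ λ v → (iterM τ k m ≡ just v) × (v % 2 ≡ bit (z k)))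
  × (iterM τ l m ≡ nothing)

nth : {A : Set} → List A → ℕ → Maybe A
nth [] _ = nothing
nth (x ∷ xs) zero = just x
nth (x ∷ xs) (suc i) = nth xs i

-- path(w,s,m): the i-th term (nothing if undefined).
-- m_{i+1} = a_j[s](m_i) with j = (i mod n) + 1, i.e. the (i mod n)-th
-- element of reverse w = a_1 ∷ ⋯ ∷ a_n.
pathAt : PFun → Word → ℕ → ℕ → Maybe ℕ
pathAt s w m zero = just m
pathAt s [] m (suc i) = nothing
pathAt s w@(_ ∷ _) m (suc i) =
  pathAt s w m i >>= λ x →
  nth (reverse w) (i % length w) >>= λ a → applyLetter s a x

InSet : PFun → Word → ℕ → ℕ → Set
InSet s w m n = Σ ℕ λ i → pathAt s w m i ≡ just n

NonemptySubword : Word → Word → Set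
NonemptySubword w' w = (w' ≢ []) × (Σ Word λ u → Σ Word λ v → u ++ w' ++ v ≡ w)

record Pre : Set where
  constructor ⟨_,_,_⟩
  field
    s    : PFun
    F    : List Word
    mbar : List (Word × ℕ)     -- graph of the partial function m̄
open Pre public

_∈F_ : Word → List Word → Set
w ∈F F = Any (w ≈w_) F

IsCond : (Perm → Set) → (ℕ → Bool) → Pre → Set
IsCond G z p =
  IsInjPFun (s p)
  × All (λ w → InW G w × NotInG w) (F p)
  × All (λ e → proj₁ e ∈F F p) (mbar p)
  × (∀ {w w' m m'} → (w , m) ∈ mbar p → (w' , m') ∈ mbar p → w ≈w w' → m ≡ m')
  × (∀ {w m} → (w , m) ∈ mbar p →
       Σ ℕ λ l → ExactlyCodes (applyWord (s p) w) z l m)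
  × (∀ {w w' m m'} → (w , m) ∈ mbar p → (w' , m') ∈ mbar p → ¬ (w ≈w w') →
       ∀ n → InSet (s p) w m n → InSet (s p) w' m' n → ⊥)

_≤Q_ : Pre → Pre → Set
q ≤Q p =
  (∀ {e} → e ∈ s p → e ∈ s q)
  × (∀ {w} → w ∈F F p → w ∈F F q)
  × (∀ {w m} → (w , m) ∈ mbar p →
       Σ Word λ w₁ → ((w₁ , m) ∈ mbar q) × (w ≈w w₁))
  × (∀ {w} → w ∈ F p → ∀ m → applyWord (s q) w m ≡ just m →
       Σ Word λ w' → NonemptySubword w' w ×
         Σ ℕ λ n → InSet (s q) w m n × (applyWord (s p) w' n ≡ just n))

module Submission where

-- The condition q is obtained from p by only enlarging the finite set of
-- promises:  q = (s^p, F^p ∪ {w}, m̄^p).  Clauses (a)-(d) for q reduce to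
-- those for p, since s and m̄ are unchanged and the new word w is a
-- reduced word outside G.  For q ≤ p the only non-trivial clause asks,
-- for each v ∈ F^p and each fixed point m of v[s^q] = v[s^p], for a
-- nonempty subword v' of v and a point of set(v, s^q, m) fixed by
-- v'[s^p].  Take v' = v itself and the point m = m₀ of the path: this
-- works because every word of F^p is nonempty.

open import Defs
open import Data.Nat using (ℕ)
open import Data.Bool using (Bool)
open import Data.Product using (Σ; _×_; _,_)
open import Data.List using ([]; _∷_)
open import Data.List.Properties using (++-identityʳ)
open import Data.List.Relation.Unary.All using (All; _∷_; lookup)
  renaming (map to mapAll)
open import Data.List.Relation.Unary.Any using (here; there)
open import Relation.Binary.PropositionalEquality using (_≡_; _≢_; refl)
open import Data.Unit using (tt)
open import Data.Maybe using (just)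

≈ₗ-refl : ∀ a → a ≈ₗ a
≈ₗ-refl (gen a) = λ n → refl
≈ₗ-refl X       = tt
≈ₗ-refl X⁻      = tt

≈w-refl : ∀ w → w ≈w w
≈w-refl []      = []
≈w-refl (a ∷ w) = ≈ₗ-refl a ∷ ≈w-refl w

addWord : Word → Pre → Pre
addWord w p = ⟨ s p , w ∷ F p , mbar p ⟩

selfWitness : ∀ s {v} → v ≢ [] → ∀ m → applyWord s v m ≡ just m →
  Σ Word λ v' → NonemptySubword v' v ×
    Σ ℕ λ n → InSet s v m n × (applyWord s v' n ≡ just n)
selfWitness s {v} v≢[] m fixed =
  v , (v≢[] , [] , [] , ++-identityʳ v) , m , (0 , refl) , fixed

addWord-isCond : ∀ {G z w p} → InW G w → NotInG w →
  IsCond G z p → IsCond G z (addWord w p)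
addWord-isCond inW notInG (inj , allF , mbarInF , functional , codes , disjoint) =
  inj , (inW , notInG) ∷ allF , mapAll there mbarInF , functional , codes , disjoint

addWord-≤ : ∀ w p → All (λ v → v ≢ []) (F p) → addWord w p ≤Q p
addWord-≤ w p nonempty =
  (λ e∈s → e∈s) ,
  there ,
  (λ {v} e∈mbar → v , e∈mbar , ≈w-refl v) ,
  (λ v∈F → selfWitness (s p) (lookup nonempty v∈F))

lemma3p10 : (G : Perm → Set) → IsSubgroup G → Cofinitary G →
    (z : ℕ → Bool) → NonPeriodic z →
    (w : Word) → InW G w → NotInG w →
    (p : Pre) → IsCond G z p →
    Σ Pre λ q → IsCond G z q × (q ≤Q p) × (w ∈F F q)
lemma3p10 G _ _ z _ w inW notInG p condP@(_ , allF , _) =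
  addWord w p ,
  addWord-isCond inW notInG condP ,
  addWord-≤ w p (mapAll (λ { (_ , v≢[] , _) → v≢[] }) allF) ,
  here (≈w-refl w)
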